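{- Let $\{u_n\}_{n\geq0}$ be defined by $u_0=0$, $u_1=1$, $u_{n+1}=4u_n-7u_{n-1}$ for $n\geq1$, and let $p\neq3,7$ be an odd prime. Then $$\frac{u_{p-1}}{p}\equiv\frac{5}{42}\sum_{k=1}^{\frac{p-1}{3}}\frac{8^k}{k}+\frac{1}{14}\sum_{k=1}^{\frac{p-1}{3}}\frac{8^k}{3k-2}+\frac47q_p(2)\pmod p\quad\text{if }p\equiv1\pmod3;$$ $$\frac{u_{p+1}}{p}\equiv\frac12\sum_{k=1}^{\frac{p+1}{3}}\frac{8^k}{3k-2}-\frac16\sum_{k=1}^{\frac{p-2}{3}}\frac{8^k}{k}\pmod p\quad\text{if }p\equiv2\pmod3.$$
   Context: For an odd prime $p$ and an integer $x$ with $p\nmid x$, $q_p(x)=\frac{x^{p-1}-1}{p}$. Congruences modulo $p$ between rationals with denominators prime to $p$ are understood in the ring of $p$-integral rationals. -}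

module Defs where

open import Data.Nat as ℕ using (ℕ; zero; suc; _∸_; _^_)
open import Data.Nat.Primality using (Prime; prime⇒nonZero)
import Data.Integer as ℤ
open import Data.Integer using (ℤ; +_)
open import Data.Rational as ℚ using (ℚ; ↥_; ↧ₙ_; 0ℚ; _-_)
open import Data.Nat.Divisibility as ℕD using ()
open import Data.Product using (_×_)
open import Relation.Nullary using (¬_)

u : ℕ → ℤ
u zero = + 0
u (suc zero) = + 1
u (suc (suc n)) = (+ 4) ℤ.* u (suc n) ℤ.- (+ 7) ℤ.* u n

_/ₚ_[_] : ℤ → (p : ℕ) → Prime p → ℚ
z /ₚ p [ pr ] = ℚ._/_ z p {{prime⇒nonZero pr}}

q : (p : ℕ) → Prime p → ℕ → ℚ
q p pr x = ((+ (x ^ (p ∸ 1))) ℤ.- (+ 1)) /ₚ p [ pr ]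

Σ₁ : ℕ → (ℕ → ℚ) → ℚ
Σ₁ zero f = 0ℚ
Σ₁ (suc m) f = Σ₁ m f ℚ.+ f (suc m)

-- Congruence modulo p in the ring of p-integral rationals:
-- x ≡ y (mod p) iff x - y = a/b (lowest terms) with p ∣ a and p ∤ b.
_≡_[modℚ_] : ℚ → ℚ → ℕ → Set
x ≡ y [modℚ p ] = (p ℕD.∣ ℤ.∣ ↥ (x - y) ∣) × ¬ (p ℕD.∣ ↧ₙ (x - y))

{-# OPTIONS --safe #-}
-- α = 1 - 2ω, with ω a primitive cube root of unity, is a root of x² - 4x + 7, so
-- uₙ = (αⁿ - ᾱⁿ)/(α - ᾱ). Expanding (1 - 2ω)ⁿ binomially groups the terms by k mod 3 into
-- the trisected sums trisectionᵣ n = Σ_{k ≡ r (mod 3)} C(n,k)(-2)ᵏ, and then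
-- 2uₙ = trisection₂ n - trisection₁ n and trisection₀ n + trisection₁ n + trisection₂ n = (-1)ⁿ;
-- both follow from Pascal's rule, trisectionᵣ (n+1) = trisectionᵣ n - 2 trisectionᵣ₋₁ n.
-- At n = p the recurrence writes u_{p-1} (p ≡ 1 mod 3), resp. u_{p+1} (p ≡ 2 mod 3), through
-- trisection₀ p - 1, trisection₁ p and, for p ≡ 1, the top term (-2)ᵖ, which yields q_p(2).
-- After dividing by p, C(p,k)(-2)ᵏ/p ≡ -2ᵏ/k for 0 < k < p, because C(p,k)/p = C(p-1,k-1)/k
-- and C(p-1,k-1) ≡ (-1)^(k-1); the indices k = 3j and k = 3j - 2 give 8ʲ/(3j) and 8ʲ/(4(3j - 2)).

module Submission where

open import Defs

-- Scopes ℚ's arithmetic operators, whose names clash with ℕ's in the statement of corollary4p4.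
module _ where

  open import Level using (0ℓ)
  open import Algebra.Bundles using (CommutativeRing)
  open import Data.Empty using (⊥-elim)
  open import Data.Maybe.Base using (Maybe; just; nothing)
  open import Data.Product using (_×_; _,_)
  open import Data.Sum using (inj₁; inj₂)
  open import Data.Nat as ℕ using (ℕ; zero; suc; _∸_)
  import Data.Nat.Properties as ℕP
  open import Data.Nat.Combinatorics using (_C_; nCk+nC[k+1]≡[n+1]C[k+1]; k>n⇒nCk≡0; nCn≡1; nC1≡n)
  open import Data.Nat.Divisibility using (_∣_; _∤_; divides; ∣-trans; ∣1⇒≡1; m∣m*n; ∣n⇒∣m*n; _∣0; ∣⇒≤)
  open import Data.Nat.DivMod using (_%_; m≡m%n+[m/n]*n; m%n<n; m*n/n≡m)
  open import Data.Nat.GCD using (gcd)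
  open import Data.Nat.Primality
    using (Prime; prime⇒nonZero; prime⇒irreducible; euclidsLemma; ¬prime[1]; prime?; prime[2])
  import Data.Nat.Tactic.RingSolver as ℕ-Solver
  import Data.Integer as ℤ
  open import Data.Integer using (ℤ; +_; -[1+_])
  import Data.Integer.Properties as ℤP
  import Data.Integer.Divisibility.Signed as ℤ∣
  open import Data.Integer.Tactic.RingSolver using (solve-∀)
  open import Data.Rational as ℚ using (ℚ; ↥_; ↧ₙ_; _/_; 0ℚ; 1ℚ; _+_; _*_; -_; _-_)
  import Data.Rational.Properties as ℚP
  open import Data.Rational.Literals using (fromℤ)
  import Data.Rational.Unnormalised as ℚᵘ
  import Data.Rational.Unnormalised.Properties as ℚᵘP
  open import Algebra.Properties.CommutativeSemiring.Exp
    (CommutativeRing.commutativeSemiring ℚP.+-*-commutativeRing) using (^-distrib-*)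
    renaming (_^_ to _^ℚ_)
  open import Relation.Nullary using (yes; no)
  open import Relation.Nullary.Decidable using (from-yes)
  open import Relation.Binary.PropositionalEquality
  import Tactic.RingSolver as RingSolver
  import Tactic.RingSolver.Core.AlmostCommutativeRing as ACR

  -- Rational arithmetic

  ℚ-ring : ACR.AlmostCommutativeRing 0ℓ 0ℓ
  ℚ-ring = ACR.fromCommutativeRing ℚP.+-*-commutativeRing 0≟
    where
    0≟ : ∀ x → Maybe (0ℚ ≡ x)
    0≟ x with 0ℚ ℚP.≟ x
    ... | yes e = just e
    ... | no _  = nothing

  fromℚᵘ-homo-* : ∀ x y → ℚ.fromℚᵘ (x ℚᵘ.* y) ≡ ℚ.fromℚᵘ x * ℚ.fromℚᵘ y
  fromℚᵘ-homo-* x y = ℚP.toℚᵘ-injective (ℚᵘP.≃-trans (ℚP.toℚᵘ-fromℚᵘ (x ℚᵘ.* y))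
    (ℚᵘP.≃-sym (ℚᵘP.≃-trans (ℚP.toℚᵘ-homo-* (ℚ.fromℚᵘ x) (ℚ.fromℚᵘ y))
                            (ℚᵘP.*-cong (ℚP.toℚᵘ-fromℚᵘ x) (ℚP.toℚᵘ-fromℚᵘ y)))))

  *≡*⇒/≡ : ∀ a b c d .{{_ : ℕ.NonZero b}} .{{_ : ℕ.NonZero d}} →
           a ℤ.* + d ≡ c ℤ.* + b → a / b ≡ c / d
  *≡*⇒/≡ a (suc b) c (suc d) eq = ℚP.fromℚᵘ-cong {ℚᵘ.mkℚᵘ a b} {ℚᵘ.mkℚᵘ c d} (ℚᵘ.*≡* eq)

  /-*-/ : ∀ a b m n .{{_ : ℕ.NonZero m}} .{{_ : ℕ.NonZero n}} →
          (a / m) * (b / n) ≡ ((a ℤ.* b) / (m ℕ.* n)) {{ℕP.m*n≢0 m n}}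
  /-*-/ a b (suc m) (suc n) = sym (fromℚᵘ-homo-* (ℚᵘ.mkℚᵘ a m) (ℚᵘ.mkℚᵘ b n))

  fromℤ≡/1 : ∀ z → fromℤ z ≡ z / 1
  fromℤ≡/1 z = sym (ℚP.↥p/↧p≡p (fromℤ z))

  fromℤ-homo-+ : ∀ a b → fromℤ (a ℤ.+ b) ≡ fromℤ a + fromℤ b
  fromℤ-homo-+ a b = trans (fromℤ≡/1 (a ℤ.+ b)) (*≡*⇒/≡ (a ℤ.+ b) 1 (a ℤ.* + 1 ℤ.+ b ℤ.* + 1) 1 (eq a b))
    where
    eq : ∀ a b → (a ℤ.+ b) ℤ.* + 1 ≡ (a ℤ.* + 1 ℤ.+ b ℤ.* + 1) ℤ.* + 1
    eq = solve-∀

  fromℤ-homo-* : ∀ a b → fromℤ (a ℤ.* b) ≡ fromℤ a * fromℤ b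
  fromℤ-homo-* a b = fromℤ≡/1 (a ℤ.* b)

  fromℤ-homo‿- : ∀ a → fromℤ (ℤ.- a) ≡ - fromℤ a
  fromℤ-homo‿- (+ zero)  = refl
  fromℤ-homo‿- (+ suc n) = refl
  fromℤ-homo‿- -[1+ n ]  = refl

  fromℤ-homo-- : ∀ a b → fromℤ (a ℤ.- b) ≡ fromℤ a - fromℤ b
  fromℤ-homo-- a b = trans (fromℤ-homo-+ a (ℤ.- b)) (cong (λ x → fromℤ a + x) (fromℤ-homo‿- b))

  /-as-* : ∀ z n .{{_ : ℕ.NonZero n}} → z / n ≡ fromℤ z * (+ 1 / n)
  /-as-* z n = begin
    z / n                         ≡⟨ ℚP./-cong (ℤP.*-identityʳ z) (ℕP.*-identityˡ n) ⟨
    (z ℤ.* + 1) / (1 ℕ.* n)       ≡⟨ /-*-/ z (+ 1) 1 n ⟨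
    (z / 1) * (+ 1 / n)           ≡⟨ cong (_* (+ 1 / n)) (fromℤ≡/1 z) ⟨
    fromℤ z * (+ 1 / n)           ∎
    where
    open ≡-Reasoning
    instance _ = ℕP.m*n≢0 1 n

  1/-distrib-* : ∀ m n .{{_ : ℕ.NonZero m}} .{{_ : ℕ.NonZero n}} →
                 (+ 1 / (m ℕ.* n)) {{ℕP.m*n≢0 m n}} ≡ (+ 1 / m) * (+ 1 / n)
  1/-distrib-* m n = sym (/-*-/ (+ 1) (+ 1) m n)

  fromℤ-homo-^ : ∀ a k → fromℤ (+ (a ℕ.^ k)) ≡ fromℤ (+ a) ^ℚ k
  fromℤ-homo-^ a zero    = refl
  fromℤ-homo-^ a (suc k) = begin
    fromℤ (+ (a ℕ.* a ℕ.^ k))         ≡⟨ cong fromℤ (ℤP.pos-* a (a ℕ.^ k)) ⟩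
    fromℤ (+ a ℤ.* + (a ℕ.^ k))       ≡⟨ fromℤ-homo-* (+ a) (+ (a ℕ.^ k)) ⟩
    fromℤ (+ a) * fromℤ (+ (a ℕ.^ k)) ≡⟨ cong (fromℤ (+ a) *_) (fromℤ-homo-^ a k) ⟩
    fromℤ (+ a) ^ℚ suc k              ∎
    where open ≡-Reasoning

  ^/-as-* : ∀ a k n .{{_ : ℕ.NonZero n}} → (+ (a ℕ.^ k)) / n ≡ fromℤ (+ a) ^ℚ k * (+ 1 / n)
  ^/-as-* a k n = trans (/-as-* (+ (a ℕ.^ k)) n) (cong (_* (+ 1 / n)) (fromℤ-homo-^ a k))

  2^[i*3]≡8^i : ∀ i → fromℤ (+ 2) ^ℚ (i ℕ.* 3) ≡ fromℤ (+ 8) ^ℚ i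
  2^[i*3]≡8^i zero    = refl
  2^[i*3]≡8^i (suc i) = trans (cube (fromℤ (+ 2) ^ℚ (i ℕ.* 3))) (cong (fromℤ (+ 8) *_) (2^[i*3]≡8^i i))
    where
    cube : ∀ x → fromℤ (+ 2) * (fromℤ (+ 2) * (fromℤ (+ 2) * x)) ≡ fromℤ (+ 8) * x
    cube = RingSolver.solve-∀ ℚ-ring

  -- Finite sums

  Σ₁-cong : ∀ m {f g : ℕ → ℚ} → (∀ k → f (suc k) ≡ g (suc k)) → Σ₁ m f ≡ Σ₁ m g
  Σ₁-cong zero    eq = refl
  Σ₁-cong (suc m) eq = cong₂ _+_ (Σ₁-cong m eq) (eq m)

  Σ₁-+ : ∀ m (f g : ℕ → ℚ) → Σ₁ m (λ k → f k + g k) ≡ Σ₁ m f + Σ₁ m g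
  Σ₁-+ zero    f g = refl
  Σ₁-+ (suc m) f g = trans (cong (_+ (f (suc m) + g (suc m))) (Σ₁-+ m f g))
    (interchange (Σ₁ m f) (Σ₁ m g) (f (suc m)) (g (suc m)))
    where
    interchange : ∀ a b c d → (a + b) + (c + d) ≡ (a + c) + (b + d)
    interchange = RingSolver.solve-∀ ℚ-ring

  Σ₁-*ˡ : ∀ m c (f : ℕ → ℚ) → Σ₁ m (λ k → c * f k) ≡ c * Σ₁ m f
  Σ₁-*ˡ zero    c f = sym (ℚP.*-zeroʳ c)
  Σ₁-*ˡ (suc m) c f = trans (cong (_+ c * f (suc m)) (Σ₁-*ˡ m c f))
    (sym (ℚP.*-distribˡ-+ c (Σ₁ m f) (f (suc m))))

  Σ₁-*ʳ : ∀ m (f : ℕ → ℚ) c → Σ₁ m f * c ≡ Σ₁ m (λ k → f k * c)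
  Σ₁-*ʳ zero    f c = ℚP.*-zeroˡ c
  Σ₁-*ʳ (suc m) f c = trans (ℚP.*-distribʳ-+ c (Σ₁ m f) (f (suc m))) (cong (_+ f (suc m) * c) (Σ₁-*ʳ m f c))

  Σ₁-pred : ∀ n (f : ℕ → ℚ) → Σ₁ (suc n) (λ k → f (ℕ.pred k)) ≡ f 0 + Σ₁ n f
  Σ₁-pred zero    f = ℚP.+-comm 0ℚ (f 0)
  Σ₁-pred (suc n) f = trans (cong (_+ f (suc n)) (Σ₁-pred n f)) (ℚP.+-assoc (f 0) (Σ₁ n f) (f (suc n)))

  cycle₃ : ℚ → ℚ → ℚ → ℕ → ℚ
  cycle₃ a b c zero    = a
  cycle₃ a b c (suc k) = cycle₃ b c a k

  cycle₃-*3 : ∀ a b c m → cycle₃ a b c (m ℕ.* 3) ≡ a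
  cycle₃-*3 a b c zero    = refl
  cycle₃-*3 a b c (suc m) = cycle₃-*3 a b c m

  Σ₁-cycle₃ : ∀ m a b c (f : ℕ → ℚ) →
    Σ₁ (m ℕ.* 3) (λ k → f k * cycle₃ a b c k) ≡
    Σ₁ m (λ j → b * f (j ℕ.* 3 ∸ 2) + c * f (j ℕ.* 3 ∸ 1) + a * f (j ℕ.* 3))
  Σ₁-cycle₃ zero    a b c f = refl
  Σ₁-cycle₃ (suc m) a b c f = begin
    Σ₁ (m ℕ.* 3) F + f (1 ℕ.+ 3m) * cycle₃ b c a 3m + f (2 ℕ.+ 3m) * cycle₃ c a b 3m + f (3 ℕ.+ 3m) * cycle₃ a b c 3m
      ≡⟨ cong₂ (λ s w → s + f (1 ℕ.+ 3m) * w + f (2 ℕ.+ 3m) * cycle₃ c a b 3m + f (3 ℕ.+ 3m) * cycle₃ a b c 3m)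
               (Σ₁-cycle₃ m a b c f) (cycle₃-*3 b c a m) ⟩
    S + f (1 ℕ.+ 3m) * b + f (2 ℕ.+ 3m) * cycle₃ c a b 3m + f (3 ℕ.+ 3m) * cycle₃ a b c 3m
      ≡⟨ cong₂ (λ w w′ → S + f (1 ℕ.+ 3m) * b + f (2 ℕ.+ 3m) * w + f (3 ℕ.+ 3m) * w′)
               (cycle₃-*3 c a b m) (cycle₃-*3 a b c m) ⟩
    S + f (1 ℕ.+ 3m) * b + f (2 ℕ.+ 3m) * c + f (3 ℕ.+ 3m) * a
      ≡⟨ regroup S (f (1 ℕ.+ 3m)) (f (2 ℕ.+ 3m)) (f (3 ℕ.+ 3m)) a b c ⟩
    S + (b * f (1 ℕ.+ 3m) + c * f (2 ℕ.+ 3m) + a * f (3 ℕ.+ 3m)) ∎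
    where
    open ≡-Reasoning
    3m = m ℕ.* 3
    F : ℕ → ℚ
    F k = f k * cycle₃ a b c k
    S = Σ₁ m (λ j → b * f (j ℕ.* 3 ∸ 2) + c * f (j ℕ.* 3 ∸ 1) + a * f (j ℕ.* 3))
    regroup : ∀ s x y z a b c → s + x * b + y * c + z * a ≡ s + (b * x + c * y + a * z)
    regroup = RingSolver.solve-∀ ℚ-ring

  Σ₁-multiplesOf3 : ∀ m (f : ℕ → ℚ) →
    Σ₁ (m ℕ.* 3) (λ k → f k * cycle₃ 1ℚ 0ℚ 0ℚ k) ≡ Σ₁ m (λ j → f (j ℕ.* 3))
  Σ₁-multiplesOf3 m f = trans (Σ₁-cycle₃ m 1ℚ 0ℚ 0ℚ f)
    (Σ₁-cong m (λ j → select (f (suc j ℕ.* 3 ∸ 2)) (f (suc j ℕ.* 3 ∸ 1)) (f (suc j ℕ.* 3))))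
    where
    select : ∀ x y z → 0ℚ * x + 0ℚ * y + 1ℚ * z ≡ z
    select = RingSolver.solve-∀ ℚ-ring

  Σ₁-oneModulo3 : ∀ m (f : ℕ → ℚ) →
    Σ₁ (m ℕ.* 3) (λ k → f k * cycle₃ 0ℚ 1ℚ 0ℚ k) ≡ Σ₁ m (λ j → f (j ℕ.* 3 ∸ 2))
  Σ₁-oneModulo3 m f = trans (Σ₁-cycle₃ m 0ℚ 1ℚ 0ℚ f)
    (Σ₁-cong m (λ j → select (f (suc j ℕ.* 3 ∸ 2)) (f (suc j ℕ.* 3 ∸ 1)) (f (suc j ℕ.* 3))))
    where
    select : ∀ x y z → 1ℚ * x + 0ℚ * y + 0ℚ * z ≡ x
    select = RingSolver.solve-∀ ℚ-ring

  -- Trisected binomial sums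

  binomialSum : ℚ → ℕ → (ℕ → ℚ) → ℚ
  binomialSum x n χ = χ 0 + Σ₁ n (λ k → fromℤ (+ (n C k)) * x ^ℚ k * χ k)

  binomialSum-suc : ∀ x n χ →
    binomialSum x (suc n) χ ≡ binomialSum x n χ + x * binomialSum x n (λ k → χ (suc k))
  binomialSum-suc x n χ = begin
    χ 0 + Σ₁ (suc n) (λ k → fromℤ (+ (suc n C k)) * x ^ℚ k * χ k)
      ≡⟨ cong (_+_ (χ 0)) (Σ₁-cong (suc n) pascal) ⟩
    χ 0 + Σ₁ (suc n) (λ k → x * b′ (ℕ.pred k) + b k)
      ≡⟨ cong (_+_ (χ 0)) (Σ₁-+ (suc n) (λ k → x * b′ (ℕ.pred k)) b) ⟩
    χ 0 + (Σ₁ (suc n) (λ k → x * b′ (ℕ.pred k)) + (Σ₁ n b + b (suc n)))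
      ≡⟨ cong (λ s → χ 0 + (s + (Σ₁ n b + b (suc n))))
              (trans (Σ₁-*ˡ (suc n) x (λ k → b′ (ℕ.pred k))) (cong (x *_) (Σ₁-pred n b′))) ⟩
    χ 0 + (x * (b′ 0 + Σ₁ n b′) + (Σ₁ n b + b (suc n)))
      ≡⟨ cong₂ (λ c z → χ 0 + (x * (c + Σ₁ n b′) + (Σ₁ n b + z))) (ℚP.*-identityˡ (χ 1)) b[n+1]≡0 ⟩
    χ 0 + (x * (χ 1 + Σ₁ n b′) + (Σ₁ n b + 0ℚ))
      ≡⟨ rearrange (χ 0) x (χ 1) (Σ₁ n b′) (Σ₁ n b) ⟩
    (χ 0 + Σ₁ n b) + x * (χ 1 + Σ₁ n b′) ∎
    where
    open ≡-Reasoning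
    b b′ : ℕ → ℚ
    b  k = fromℤ (+ (n C k)) * x ^ℚ k * χ k
    b′ k = fromℤ (+ (n C k)) * x ^ℚ k * χ (suc k)
    pascal : ∀ j → fromℤ (+ (suc n C suc j)) * x ^ℚ suc j * χ (suc j) ≡ x * b′ j + b (suc j)
    pascal j = begin
      fromℤ (+ (suc n C suc j)) * x ^ℚ suc j * χ (suc j)
        ≡⟨ cong (λ c → fromℤ (+ c) * x ^ℚ suc j * χ (suc j)) (nCk+nC[k+1]≡[n+1]C[k+1] n j) ⟨
      fromℤ (+ (n C j ℕ.+ n C suc j)) * x ^ℚ suc j * χ (suc j)
        ≡⟨ cong (λ c → c * x ^ℚ suc j * χ (suc j))
                (trans (cong fromℤ (ℤP.pos-+ (n C j) (n C suc j))) (fromℤ-homo-+ (+ (n C j)) (+ (n C suc j)))) ⟩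
      (fromℤ (+ (n C j)) + fromℤ (+ (n C suc j))) * (x * x ^ℚ j) * χ (suc j)
        ≡⟨ distribute (fromℤ (+ (n C j))) (fromℤ (+ (n C suc j))) x (x ^ℚ j) (χ (suc j)) ⟩
      x * b′ j + b (suc j) ∎
      where
      distribute : ∀ c d x y z → (c + d) * (x * y) * z ≡ x * (c * y * z) + d * (x * y) * z
      distribute = RingSolver.solve-∀ ℚ-ring
    b[n+1]≡0 : b (suc n) ≡ 0ℚ
    b[n+1]≡0 = begin
      fromℤ (+ (n C suc n)) * x ^ℚ suc n * χ (suc n)
        ≡⟨ cong (λ c → fromℤ (+ c) * x ^ℚ suc n * χ (suc n)) (k>n⇒nCk≡0 (ℕP.n<1+n n)) ⟩
      0ℚ * x ^ℚ suc n * χ (suc n)                    ≡⟨ cong (_* χ (suc n)) (ℚP.*-zeroˡ (x ^ℚ suc n)) ⟩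
      0ℚ * χ (suc n)                                 ≡⟨ ℚP.*-zeroˡ (χ (suc n)) ⟩
      0ℚ                                             ∎
    rearrange : ∀ a x c s′ s → a + (x * (c + s′) + (s + 0ℚ)) ≡ (a + s) + x * (c + s′)
    rearrange = RingSolver.solve-∀ ℚ-ring

  -2ℚ : ℚ
  -2ℚ = fromℤ -[1+ 1 ]

  trisection₀ trisection₁ trisection₂ : ℕ → ℚ
  trisection₀ n = binomialSum -2ℚ n (cycle₃ 1ℚ 0ℚ 0ℚ)
  trisection₁ n = binomialSum -2ℚ n (cycle₃ 0ℚ 1ℚ 0ℚ)
  trisection₂ n = binomialSum -2ℚ n (cycle₃ 0ℚ 0ℚ 1ℚ)

  trisection₀-suc : ∀ n → trisection₀ (suc n) ≡ trisection₀ n + -2ℚ * trisection₂ n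
  trisection₀-suc n = binomialSum-suc -2ℚ n (cycle₃ 1ℚ 0ℚ 0ℚ)

  trisection₁-suc : ∀ n → trisection₁ (suc n) ≡ trisection₁ n + -2ℚ * trisection₀ n
  trisection₁-suc n = binomialSum-suc -2ℚ n (cycle₃ 0ℚ 1ℚ 0ℚ)

  trisection₂-suc : ∀ n → trisection₂ (suc n) ≡ trisection₂ n + -2ℚ * trisection₁ n
  trisection₂-suc n = binomialSum-suc -2ℚ n (cycle₃ 0ℚ 0ℚ 1ℚ)

  fromℤ-u-suc-suc : ∀ n → fromℤ (u (2 ℕ.+ n)) ≡ fromℤ (+ 4) * fromℤ (u (suc n)) - fromℤ (+ 7) * fromℤ (u n)
  fromℤ-u-suc-suc n = trans (fromℤ-homo-- (+ 4 ℤ.* u (suc n)) (+ 7 ℤ.* u n))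
    (cong₂ _-_ (fromℤ-homo-* (+ 4) (u (suc n))) (fromℤ-homo-* (+ 7) (u n)))

  u-trisection : ∀ n → fromℤ (+ 2) * fromℤ (u n) ≡ trisection₂ n - trisection₁ n
  u-trisection zero          = refl
  u-trisection (suc zero)    = refl
  u-trisection (suc (suc n)) = begin
    fromℤ (+ 2) * fromℤ (u (2 ℕ.+ n))
      ≡⟨ cong (fromℤ (+ 2) *_) (fromℤ-u-suc-suc n) ⟩
    fromℤ (+ 2) * (fromℤ (+ 4) * fromℤ (u (suc n)) - fromℤ (+ 7) * fromℤ (u n))
      ≡⟨ distribute (fromℤ (u (suc n))) (fromℤ (u n)) ⟩
    fromℤ (+ 4) * (fromℤ (+ 2) * fromℤ (u (suc n))) - fromℤ (+ 7) * (fromℤ (+ 2) * fromℤ (u n))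
      ≡⟨ cong₂ (λ d d′ → fromℤ (+ 4) * d - fromℤ (+ 7) * d′) (u-trisection (suc n)) (u-trisection n) ⟩
    fromℤ (+ 4) * (trisection₂ (suc n) - trisection₁ (suc n)) - fromℤ (+ 7) * (t₂ - t₁)
      ≡⟨ cong₂ (λ a b → fromℤ (+ 4) * (a - b) - fromℤ (+ 7) * (t₂ - t₁)) (trisection₂-suc n) (trisection₁-suc n) ⟩
    fromℤ (+ 4) * ((t₂ + -2ℚ * t₁) - (t₁ + -2ℚ * t₀)) - fromℤ (+ 7) * (t₂ - t₁)
      ≡⟨ two-steps t₀ t₁ t₂ ⟩
    ((t₂ + -2ℚ * t₁) + -2ℚ * (t₁ + -2ℚ * t₀)) - ((t₁ + -2ℚ * t₀) + -2ℚ * (t₀ + -2ℚ * t₂))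
      ≡⟨ cong₂ (λ a b → (a + -2ℚ * b) - (b + -2ℚ * (t₀ + -2ℚ * t₂))) (trisection₂-suc n) (trisection₁-suc n) ⟨
    (trisection₂ (suc n) + -2ℚ * trisection₁ (suc n)) - (trisection₁ (suc n) + -2ℚ * (t₀ + -2ℚ * t₂))
      ≡⟨ cong (λ c → (trisection₂ (suc n) + -2ℚ * trisection₁ (suc n)) - (trisection₁ (suc n) + -2ℚ * c)) (trisection₀-suc n) ⟨
    (trisection₂ (suc n) + -2ℚ * trisection₁ (suc n)) - (trisection₁ (suc n) + -2ℚ * trisection₀ (suc n))
      ≡⟨ cong₂ _-_ (trisection₂-suc (suc n)) (trisection₁-suc (suc n)) ⟨
    trisection₂ (2 ℕ.+ n) - trisection₁ (2 ℕ.+ n) ∎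
    where
    open ≡-Reasoning
    t₀ = trisection₀ n
    t₁ = trisection₁ n
    t₂ = trisection₂ n
    distribute : ∀ a b → fromℤ (+ 2) * (fromℤ (+ 4) * a - fromℤ (+ 7) * b) ≡
                         fromℤ (+ 4) * (fromℤ (+ 2) * a) - fromℤ (+ 7) * (fromℤ (+ 2) * b)
    distribute = RingSolver.solve-∀ ℚ-ring
    two-steps : ∀ t₀ t₁ t₂ →
      fromℤ (+ 4) * ((t₂ + -2ℚ * t₁) - (t₁ + -2ℚ * t₀)) - fromℤ (+ 7) * (t₂ - t₁) ≡
      ((t₂ + -2ℚ * t₁) + -2ℚ * (t₁ + -2ℚ * t₀)) - ((t₁ + -2ℚ * t₀) + -2ℚ * (t₀ + -2ℚ * t₂))
    two-steps = RingSolver.solve-∀ ℚ-ring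

  trisection-total : ∀ n → trisection₀ n + trisection₁ n + trisection₂ n ≡ (- 1ℚ) ^ℚ n
  trisection-total zero    = refl
  trisection-total (suc n) = begin
    trisection₀ (suc n) + trisection₁ (suc n) + trisection₂ (suc n)
      ≡⟨ cong₂ _+_ (cong₂ _+_ (trisection₀-suc n) (trisection₁-suc n)) (trisection₂-suc n) ⟩
    (t₀ + -2ℚ * t₂) + (t₁ + -2ℚ * t₀) + (t₂ + -2ℚ * t₁)
      ≡⟨ collect t₀ t₁ t₂ ⟩
    (- 1ℚ) * (t₀ + t₁ + t₂)
      ≡⟨ cong ((- 1ℚ) *_) (trisection-total n) ⟩
    (- 1ℚ) ^ℚ suc n ∎
    where
    open ≡-Reasoning
    t₀ = trisection₀ n
    t₁ = trisection₁ n
    t₂ = trisection₂ n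
    collect : ∀ t₀ t₁ t₂ → (t₀ + -2ℚ * t₂) + (t₁ + -2ℚ * t₀) + (t₂ + -2ℚ * t₁) ≡ (- 1ℚ) * (t₀ + t₁ + t₂)
    collect = RingSolver.solve-∀ ℚ-ring

  u-suc-trisection : ∀ n → fromℤ (+ 2) * fromℤ (u (suc n)) ≡
    (trisection₂ n + -2ℚ * trisection₁ n) - (trisection₁ n + -2ℚ * trisection₀ n)
  u-suc-trisection n = trans (u-trisection (suc n)) (cong₂ _-_ (trisection₂-suc n) (trisection₁-suc n))

  trisection₂-odd : ∀ n → (- 1ℚ) ^ℚ n ≡ - 1ℚ → trisection₂ n ≡ - 1ℚ - trisection₀ n - trisection₁ n
  trisection₂-odd n odd = trans (isolate (trisection₀ n) (trisection₁ n) (trisection₂ n))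
    (cong (λ s → s - trisection₀ n - trisection₁ n) (trans (trisection-total n) odd))
    where
    isolate : ∀ a b c → c ≡ (a + b + c) - a - b
    isolate = RingSolver.solve-∀ ℚ-ring

  binomialTerm : ℕ → ℕ → ℚ
  binomialTerm n k = fromℤ (+ (n C k)) * -2ℚ ^ℚ k

  trisection₀[1+m*3] : ∀ m → let n = suc (m ℕ.* 3) in
    trisection₀ n ≡ 1ℚ + Σ₁ m (λ j → binomialTerm n (j ℕ.* 3))
  trisection₀[1+m*3] m = cong (_+_ 1ℚ) (begin
    Σ₁ (m ℕ.* 3) F + binomialTerm n n * cycle₃ 0ℚ 0ℚ 1ℚ (m ℕ.* 3)
      ≡⟨ cong₂ (λ s w → s + binomialTerm n n * w) (Σ₁-multiplesOf3 m (binomialTerm n)) (cycle₃-*3 0ℚ 0ℚ 1ℚ m) ⟩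
    Σ₁ m (λ j → binomialTerm n (j ℕ.* 3)) + binomialTerm n n * 0ℚ
      ≡⟨ simplify _ (binomialTerm n n) ⟩
    Σ₁ m (λ j → binomialTerm n (j ℕ.* 3)) ∎)
    where
    open ≡-Reasoning
    n = suc (m ℕ.* 3)
    F = λ k → binomialTerm n k * cycle₃ 1ℚ 0ℚ 0ℚ k
    simplify : ∀ a b → a + b * 0ℚ ≡ a
    simplify = RingSolver.solve-∀ ℚ-ring

  trisection₁[1+m*3] : ∀ m → let n = suc (m ℕ.* 3) in
    trisection₁ n ≡ Σ₁ m (λ j → binomialTerm n (j ℕ.* 3 ∸ 2)) + binomialTerm n n
  trisection₁[1+m*3] m = begin
    0ℚ + (Σ₁ (m ℕ.* 3) F + binomialTerm n n * cycle₃ 1ℚ 0ℚ 0ℚ (m ℕ.* 3))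
      ≡⟨ cong₂ (λ s w → 0ℚ + (s + binomialTerm n n * w)) (Σ₁-oneModulo3 m (binomialTerm n)) (cycle₃-*3 1ℚ 0ℚ 0ℚ m) ⟩
    0ℚ + (Σ₁ m (λ j → binomialTerm n (j ℕ.* 3 ∸ 2)) + binomialTerm n n * 1ℚ)
      ≡⟨ simplify (Σ₁ m (λ j → binomialTerm n (j ℕ.* 3 ∸ 2))) (binomialTerm n n) ⟩
    Σ₁ m (λ j → binomialTerm n (j ℕ.* 3 ∸ 2)) + binomialTerm n n ∎
    where
    open ≡-Reasoning
    n = suc (m ℕ.* 3)
    F = λ k → binomialTerm n k * cycle₃ 0ℚ 1ℚ 0ℚ k
    simplify : ∀ a b → 0ℚ + (a + b * 1ℚ) ≡ a + b
    simplify = RingSolver.solve-∀ ℚ-ring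

  trisection₀[2+m*3] : ∀ m → let n = 2 ℕ.+ m ℕ.* 3 in
    trisection₀ n ≡ 1ℚ + Σ₁ m (λ j → binomialTerm n (j ℕ.* 3))
  trisection₀[2+m*3] m = cong (_+_ 1ℚ) (begin
    Σ₁ (m ℕ.* 3) F + binomialTerm n (suc (m ℕ.* 3)) * cycle₃ 0ℚ 0ℚ 1ℚ (m ℕ.* 3) + binomialTerm n n * cycle₃ 0ℚ 1ℚ 0ℚ (m ℕ.* 3)
      ≡⟨ cong₂ (λ w w′ → Σ₁ (m ℕ.* 3) F + binomialTerm n (suc (m ℕ.* 3)) * w + binomialTerm n n * w′)
               (cycle₃-*3 0ℚ 0ℚ 1ℚ m) (cycle₃-*3 0ℚ 1ℚ 0ℚ m) ⟩
    Σ₁ (m ℕ.* 3) F + binomialTerm n (suc (m ℕ.* 3)) * 0ℚ + binomialTerm n n * 0ℚ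
      ≡⟨ cong (λ s → s + binomialTerm n (suc (m ℕ.* 3)) * 0ℚ + binomialTerm n n * 0ℚ) (Σ₁-multiplesOf3 m (binomialTerm n)) ⟩
    Σ₁ m (λ j → binomialTerm n (j ℕ.* 3)) + binomialTerm n (suc (m ℕ.* 3)) * 0ℚ + binomialTerm n n * 0ℚ
      ≡⟨ simplify _ (binomialTerm n (suc (m ℕ.* 3))) (binomialTerm n n) ⟩
    Σ₁ m (λ j → binomialTerm n (j ℕ.* 3)) ∎)
    where
    open ≡-Reasoning
    n = 2 ℕ.+ m ℕ.* 3
    F = λ k → binomialTerm n k * cycle₃ 1ℚ 0ℚ 0ℚ k
    simplify : ∀ a b c → a + b * 0ℚ + c * 0ℚ ≡ a
    simplify = RingSolver.solve-∀ ℚ-ring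

  trisection₁[2+m*3] : ∀ m → let n = 2 ℕ.+ m ℕ.* 3 in
    trisection₁ n ≡ Σ₁ (suc m) (λ j → binomialTerm n (j ℕ.* 3 ∸ 2))
  trisection₁[2+m*3] m = begin
    0ℚ + (Σ₁ (m ℕ.* 3) F + binomialTerm n (suc (m ℕ.* 3)) * cycle₃ 1ℚ 0ℚ 0ℚ (m ℕ.* 3) + binomialTerm n n * cycle₃ 0ℚ 0ℚ 1ℚ (m ℕ.* 3))
      ≡⟨ cong₂ (λ w w′ → 0ℚ + (Σ₁ (m ℕ.* 3) F + binomialTerm n (suc (m ℕ.* 3)) * w + binomialTerm n n * w′))
               (cycle₃-*3 1ℚ 0ℚ 0ℚ m) (cycle₃-*3 0ℚ 0ℚ 1ℚ m) ⟩
    0ℚ + (Σ₁ (m ℕ.* 3) F + binomialTerm n (suc (m ℕ.* 3)) * 1ℚ + binomialTerm n n * 0ℚ)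
      ≡⟨ cong (λ s → 0ℚ + (s + binomialTerm n (suc (m ℕ.* 3)) * 1ℚ + binomialTerm n n * 0ℚ)) (Σ₁-oneModulo3 m (binomialTerm n)) ⟩
    0ℚ + (Σ₁ m (λ j → binomialTerm n (j ℕ.* 3 ∸ 2)) + binomialTerm n (suc (m ℕ.* 3)) * 1ℚ + binomialTerm n n * 0ℚ)
      ≡⟨ simplify (Σ₁ m (λ j → binomialTerm n (j ℕ.* 3 ∸ 2))) (binomialTerm n (suc (m ℕ.* 3))) (binomialTerm n n) ⟩
    Σ₁ (suc m) (λ j → binomialTerm n (j ℕ.* 3 ∸ 2)) ∎
    where
    open ≡-Reasoning
    n = 2 ℕ.+ m ℕ.* 3
    F = λ k → binomialTerm n k * cycle₃ 0ℚ 1ℚ 0ℚ k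
    simplify : ∀ a b c → 0ℚ + (a + b * 1ℚ + c * 0ℚ) ≡ a + b
    simplify = RingSolver.solve-∀ ℚ-ring

  binomialTerm-diag : ∀ n → (- 1ℚ) ^ℚ n ≡ - 1ℚ → binomialTerm n n ≡ - (fromℤ (+ 2) ^ℚ n)
  binomialTerm-diag n odd = begin
    fromℤ (+ (n C n)) * -2ℚ ^ℚ n              ≡⟨ cong (λ c → fromℤ (+ c) * -2ℚ ^ℚ n) (nCn≡1 n) ⟩
    1ℚ * -2ℚ ^ℚ n                             ≡⟨ ℚP.*-identityˡ (-2ℚ ^ℚ n) ⟩
    ((- 1ℚ) * fromℤ (+ 2)) ^ℚ n               ≡⟨ ^-distrib-* (- 1ℚ) (fromℤ (+ 2)) n ⟩
    (- 1ℚ) ^ℚ n * fromℤ (+ 2) ^ℚ n            ≡⟨ cong (_* fromℤ (+ 2) ^ℚ n) odd ⟩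
    (- 1ℚ) * fromℤ (+ 2) ^ℚ n                 ≡⟨ ℚP.neg-distribˡ-* 1ℚ (fromℤ (+ 2) ^ℚ n) ⟨
    - (1ℚ * fromℤ (+ 2) ^ℚ n)                 ≡⟨ cong -_ (ℚP.*-identityˡ (fromℤ (+ 2) ^ℚ n)) ⟩
    - (fromℤ (+ 2) ^ℚ n)                      ∎
    where open ≡-Reasoning

  -- 14 u(3m) = 4 · 2u(3m + 1) - 2u(3m + 2), and the top term of trisection₁ (3m + 1) is -2·2³ᵐ.
  u[m*3]-expansion : ∀ m → let n = suc (m ℕ.* 3) in (- 1ℚ) ^ℚ n ≡ - 1ℚ →
    fromℤ (u (m ℕ.* 3)) ≡
      (-[1+ 4 ] / 14) * Σ₁ m (λ j → binomialTerm n (j ℕ.* 3))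
      + (-[1+ 1 ] / 7) * Σ₁ m (λ j → binomialTerm n (j ℕ.* 3 ∸ 2))
      + (+ 4 / 7) * (fromℤ (+ 2) ^ℚ (m ℕ.* 3) - 1ℚ)
  u[m*3]-expansion m odd = begin
    U₀
      ≡⟨ solve-U₀ U₀ U₁ ⟩
    Φ (fromℤ (+ 2) * U₁) (fromℤ (+ 2) * (fromℤ (+ 4) * U₁ - fromℤ (+ 7) * U₀))
      ≡⟨ cong (λ x → Φ (fromℤ (+ 2) * U₁) (fromℤ (+ 2) * x)) (fromℤ-u-suc-suc (m ℕ.* 3)) ⟨
    Φ (fromℤ (+ 2) * U₁) (fromℤ (+ 2) * fromℤ (u (suc n)))
      ≡⟨ cong₂ Φ (u-trisection n) (u-suc-trisection n) ⟩
    Φ (t₂ - t₁) ((t₂ + -2ℚ * t₁) - (t₁ + -2ℚ * t₀))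
      ≡⟨ cong (λ x → Φ (x - t₁) ((x + -2ℚ * t₁) - (t₁ + -2ℚ * t₀))) (trisection₂-odd n odd) ⟩
    Ψ t₀ t₁
      ≡⟨ cong₂ Ψ (trisection₀[1+m*3] m) (trans (trisection₁[1+m*3] m) (cong (_+_ A₁) (binomialTerm-diag n odd))) ⟩
    Ψ (1ℚ + A₀) (A₁ + - (fromℤ (+ 2) * W))
      ≡⟨ collect A₀ A₁ W ⟩
    (-[1+ 4 ] / 14) * A₀ + (-[1+ 1 ] / 7) * A₁ + (+ 4 / 7) * (W - 1ℚ) ∎
    where
    open ≡-Reasoning
    n = suc (m ℕ.* 3)
    U₀ = fromℤ (u (m ℕ.* 3))
    U₁ = fromℤ (u n)
    t₀ = trisection₀ n
    t₁ = trisection₁ n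
    t₂ = trisection₂ n
    A₀ = Σ₁ m (λ j → binomialTerm n (j ℕ.* 3))
    A₁ = Σ₁ m (λ j → binomialTerm n (j ℕ.* 3 ∸ 2))
    W = fromℤ (+ 2) ^ℚ (m ℕ.* 3)
    Φ : ℚ → ℚ → ℚ
    Φ d₁ d₂ = (+ 1 / 14) * (fromℤ (+ 4) * d₁ - d₂)
    Ψ : ℚ → ℚ → ℚ
    Ψ t₀ t₁ = Φ ((- 1ℚ - t₀ - t₁) - t₁) (((- 1ℚ - t₀ - t₁) + -2ℚ * t₁) - (t₁ + -2ℚ * t₀))
    solve-U₀ : ∀ U₀ U₁ →
      U₀ ≡ (+ 1 / 14) * (fromℤ (+ 4) * (fromℤ (+ 2) * U₁) - fromℤ (+ 2) * (fromℤ (+ 4) * U₁ - fromℤ (+ 7) * U₀))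
    solve-U₀ = RingSolver.solve-∀ ℚ-ring
    collect : ∀ A₀ A₁ W → let t₀ = 1ℚ + A₀; t₁ = A₁ + - (fromℤ (+ 2) * W); t₂ = - 1ℚ - t₀ - t₁ in
              (+ 1 / 14) * (fromℤ (+ 4) * (t₂ - t₁) - ((t₂ + -2ℚ * t₁) - (t₁ + -2ℚ * t₀))) ≡
              (-[1+ 4 ] / 14) * A₀ + (-[1+ 1 ] / 7) * A₁ + (+ 4 / 7) * (W - 1ℚ)
    collect = RingSolver.solve-∀ ℚ-ring

  u[3+m*3]-expansion : ∀ m → let n = 2 ℕ.+ m ℕ.* 3 in (- 1ℚ) ^ℚ n ≡ - 1ℚ →
    fromℤ (u (suc n)) ≡
      (+ 1 / 2) * Σ₁ m (λ j → binomialTerm n (j ℕ.* 3))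
      + -2ℚ * Σ₁ (suc m) (λ j → binomialTerm n (j ℕ.* 3 ∸ 2))
  u[3+m*3]-expansion m odd = begin
    U                                                         ≡⟨ halve U ⟩
    (+ 1 / 2) * (fromℤ (+ 2) * U)
      ≡⟨ cong (_*_ (+ 1 / 2)) (u-suc-trisection n) ⟩
    (+ 1 / 2) * ((t₂ + -2ℚ * t₁) - (t₁ + -2ℚ * t₀))
      ≡⟨ cong (λ x → (+ 1 / 2) * ((x + -2ℚ * t₁) - (t₁ + -2ℚ * t₀))) (trisection₂-odd n odd) ⟩
    (+ 1 / 2) * (((- 1ℚ - t₀ - t₁) + -2ℚ * t₁) - (t₁ + -2ℚ * t₀))
      ≡⟨ cong₂ (λ t₀ t₁ → (+ 1 / 2) * (((- 1ℚ - t₀ - t₁) + -2ℚ * t₁) - (t₁ + -2ℚ * t₀)))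
               (trisection₀[2+m*3] m) (trisection₁[2+m*3] m) ⟩
    (+ 1 / 2) * (((- 1ℚ - (1ℚ + A₀) - A₁) + -2ℚ * A₁) - (A₁ + -2ℚ * (1ℚ + A₀)))
      ≡⟨ collect A₀ A₁ ⟩
    (+ 1 / 2) * A₀ + -2ℚ * A₁ ∎
    where
    open ≡-Reasoning
    n = 2 ℕ.+ m ℕ.* 3
    U = fromℤ (u (suc n))
    t₀ = trisection₀ n
    t₁ = trisection₁ n
    t₂ = trisection₂ n
    A₀ = Σ₁ m (λ j → binomialTerm n (j ℕ.* 3))
    A₁ = Σ₁ (suc m) (λ j → binomialTerm n (j ℕ.* 3 ∸ 2))
    halve : ∀ U → U ≡ (+ 1 / 2) * (fromℤ (+ 2) * U)
    halve = RingSolver.solve-∀ ℚ-ring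
    collect : ∀ A₀ A₁ → (+ 1 / 2) * (((- 1ℚ - (1ℚ + A₀) - A₁) + -2ℚ * A₁) - (A₁ + -2ℚ * (1ℚ + A₀))) ≡
              (+ 1 / 2) * A₀ + -2ℚ * A₁
    collect = RingSolver.solve-∀ ℚ-ring

  -- Congruences modulo a prime

  [k+1]*[n+1]C[k+1]≡[n+1]*nCk : ∀ n k → suc k ℕ.* (suc n C suc k) ≡ suc n ℕ.* (n C k)
  [k+1]*[n+1]C[k+1]≡[n+1]*nCk n zero =
    trans (ℕP.*-identityˡ (suc n C 1)) (trans (nC1≡n (suc n)) (sym (ℕP.*-identityʳ (suc n))))
  [k+1]*[n+1]C[k+1]≡[n+1]*nCk zero (suc k) = begin
    suc (suc k) ℕ.* (1 C suc (suc k)) ≡⟨ cong (suc (suc k) ℕ.*_) (k>n⇒nCk≡0 (ℕ.s≤s (ℕ.s≤s (ℕ.z≤n {k})))) ⟩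
    suc (suc k) ℕ.* 0                 ≡⟨ ℕP.*-zeroʳ (suc (suc k)) ⟩
    0                                 ≡⟨ cong (1 ℕ.*_) (k>n⇒nCk≡0 (ℕ.s≤s (ℕ.z≤n {k}))) ⟨
    1 ℕ.* (0 C suc k)                 ∎
    where open ≡-Reasoning
  [k+1]*[n+1]C[k+1]≡[n+1]*nCk (suc n) (suc k) = begin
    suc (suc k) ℕ.* (suc (suc n) C suc (suc k))
      ≡⟨ cong (suc (suc k) ℕ.*_) (nCk+nC[k+1]≡[n+1]C[k+1] (suc n) (suc k)) ⟨
    suc (suc k) ℕ.* (b ℕ.+ c)                         ≡⟨ split k b c ⟩
    suc k ℕ.* b ℕ.+ b ℕ.+ suc (suc k) ℕ.* c
      ≡⟨ cong₂ (λ x y → x ℕ.+ b ℕ.+ y) ([k+1]*[n+1]C[k+1]≡[n+1]*nCk n k) ([k+1]*[n+1]C[k+1]≡[n+1]*nCk n (suc k)) ⟩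
    suc n ℕ.* (n C k) ℕ.+ b ℕ.+ suc n ℕ.* (n C suc k) ≡⟨ merge n (n C k) (n C suc k) b ⟩
    suc n ℕ.* (n C k ℕ.+ n C suc k) ℕ.+ b
      ≡⟨ cong (λ x → suc n ℕ.* x ℕ.+ b) (nCk+nC[k+1]≡[n+1]C[k+1] n k) ⟩
    suc n ℕ.* b ℕ.+ b                               ≡⟨ ℕP.+-comm (suc n ℕ.* b) b ⟩
    suc (suc n) ℕ.* b                                ∎
    where
    open ≡-Reasoning
    b = suc n C suc k
    c = suc n C suc (suc k)
    split : ∀ k b c → suc (suc k) ℕ.* (b ℕ.+ c) ≡ suc k ℕ.* b ℕ.+ b ℕ.+ suc (suc k) ℕ.* c
    split = ℕ-Solver.solve-∀
    merge : ∀ n x y b → suc n ℕ.* x ℕ.+ b ℕ.+ suc n ℕ.* y ≡ suc n ℕ.* (x ℕ.+ y) ℕ.+ b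
    merge = ℕ-Solver.solve-∀

  -- 2ᵏ/k, with k written suc (k ∸ 1) as in the statement (a junk value at k = 0).
  2^k/k : ℕ → ℚ
  2^k/k k = fromℤ (+ 2) ^ℚ k * (+ 1 / suc (k ∸ 1))

  module Modulo {p : ℕ} (pr : Prime p) where

    private instance
      p≢0 : ℕ.NonZero p
      p≢0 = prime⇒nonZero pr

    Integral : ℚ → Set
    Integral x = p ∤ ↧ₙ x

    -- Divisible (x - y) unfolds to the statement's x ≡ y [modℚ p ].
    Divisible : ℚ → Set
    Divisible x = p ∣ ℤ.∣ ↥ x ∣ × Integral x

    p∤1 : p ∤ 1
    p∤1 p∣1 = ¬prime[1] (subst Prime (∣1⇒≡1 p∣1) pr)

    ∤-* : ∀ {m n} → p ∤ m → p ∤ n → p ∤ m ℕ.* n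
    ∤-* {m} {n} p∤m p∤n p∣mn with euclidsLemma m n pr p∣mn
    ... | inj₁ p∣m = p∤m p∣m
    ... | inj₂ p∣n = p∤n p∣n

    module _ (i : ℤ) (n : ℕ) .{{_ : ℕ.NonZero n}} (p∤n : p ∤ n) where
      private
        g = gcd ℤ.∣ i ∣ n
        ↧g≡n : ↧ₙ (i / n) ℕ.* g ≡ n
        ↧g≡n = trans (sym (ℤP.abs-* (ℚ.↧ (i / n)) (+ g))) (cong ℤ.∣_∣ (ℚP.↧-/ i n))
        p∤g : p ∤ g
        p∤g p∣g = p∤n (∣-trans p∣g (divides (↧ₙ (i / n)) (sym ↧g≡n)))

      /-integral : Integral (i / n)
      /-integral p∣↧ = p∤n (∣-trans p∣↧ (divides g (trans (sym ↧g≡n) (ℕP.*-comm _ g))))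

      /-divisible : p ∣ ℤ.∣ i ∣ → Divisible (i / n)
      /-divisible p∣i with euclidsLemma ℤ.∣ ↥ (i / n) ∣ g pr ↥g≡i
        where
        ↥g≡i : p ∣ ℤ.∣ ↥ (i / n) ∣ ℕ.* g
        ↥g≡i = subst (p ∣_) (trans (sym (cong ℤ.∣_∣ (ℚP.↥-/ i n))) (ℤP.abs-* (↥ (i / n)) (+ g))) p∣i
      ... | inj₁ p∣↥ = p∣↥ , /-integral
      ... | inj₂ p∣g = ⊥-elim (p∤g p∣g)

    fromℤ-integral : ∀ z → Integral (fromℤ z)
    fromℤ-integral z = p∤1

    *-integral : ∀ {x y} → Integral x → Integral y → Integral (x * y)
    *-integral {x@record{}} {y@record{}} ix iy = /-integral (↥ x ℤ.* ↥ y) (↧ₙ x ℕ.* ↧ₙ y) (∤-* ix iy)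

    ^-integral : ∀ {x} k → Integral x → Integral (x ^ℚ k)
    ^-integral zero    ix = p∤1
    ^-integral {x} (suc k) ix = *-integral {x} {x ^ℚ k} ix (^-integral k ix)

    0-divisible : Divisible 0ℚ
    0-divisible = p ∣0 , p∤1

    fromℤ-divisible : ∀ {z} → p ∣ ℤ.∣ z ∣ → Divisible (fromℤ z)
    fromℤ-divisible p∣z = p∣z , p∤1

    +-divisible : ∀ {x y} → Divisible x → Divisible y → Divisible (x + y)
    +-divisible {x@record{}} {y@record{}} (p∣x , ix) (p∣y , iy) =
      /-divisible (↥ x ℤ.* ℚ.↧ y ℤ.+ ↥ y ℤ.* ℚ.↧ x) (↧ₙ x ℕ.* ↧ₙ y) (∤-* ix iy)
        (ℤ∣.∣⇒∣ᵤ (ℤ∣.∣m∣n⇒∣m+n (ℤ∣.∣m⇒∣m*n (ℚ.↧ y) (ℤ∣.∣ᵤ⇒∣ {+ p} {↥ x} p∣x))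
                                (ℤ∣.∣m⇒∣m*n (ℚ.↧ x) (ℤ∣.∣ᵤ⇒∣ {+ p} {↥ y} p∣y))))

    *-divisible : ∀ {c x} → Integral c → Divisible x → Divisible (c * x)
    *-divisible {c@record{}} {x@record{}} ic (p∣x , ix) =
      /-divisible (↥ c ℤ.* ↥ x) (↧ₙ c ℕ.* ↧ₙ x) (∤-* ic ix)
        (subst (p ∣_) (sym (ℤP.abs-* (↥ c) (↥ x))) (∣n⇒∣m*n ℤ.∣ ↥ c ∣ p∣x))

    record _≋_ (x y : ℚ) : Set where
      constructor mk≋
      field ≋⇒≡[modℚ] : x ≡ y [modℚ p ]
    open _≋_ public

    ≋-reflexive : ∀ {x y} → x ≡ y → x ≋ y
    ≋-reflexive {x} refl = mk≋ (subst Divisible (sym (ℚP.+-inverseʳ x)) 0-divisible)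

    ≋-trans : ∀ {x y z} → x ≋ y → y ≋ z → x ≋ z
    ≋-trans {x} {y} {z} (mk≋ x≋y) (mk≋ y≋z) =
      mk≋ (subst Divisible (telescope x y z) (+-divisible {x - y} {y - z} x≋y y≋z))
      where
      telescope : ∀ x y z → (x - y) + (y - z) ≡ x - z
      telescope = RingSolver.solve-∀ ℚ-ring

    ≋-+ : ∀ {x y x′ y′} → x ≋ y → x′ ≋ y′ → (x + x′) ≋ (y + y′)
    ≋-+ {x} {y} {x′} {y′} (mk≋ x≋y) (mk≋ x′≋y′) =
      mk≋ (subst Divisible (regroup x y x′ y′) (+-divisible {x - y} {x′ - y′} x≋y x′≋y′))
      where
      regroup : ∀ x y x′ y′ → (x - y) + (x′ - y′) ≡ (x + x′) - (y + y′)
      regroup = RingSolver.solve-∀ ℚ-ring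

    ≋-*ˡ : ∀ {c x y} → Integral c → x ≋ y → (c * x) ≋ (c * y)
    ≋-*ˡ {c} {x} {y} ic (mk≋ x≋y) = mk≋ (subst Divisible (distrib c x y) (*-divisible {c} {x - y} ic x≋y))
      where
      distrib : ∀ c x y → c * (x - y) ≡ c * x - c * y
      distrib = RingSolver.solve-∀ ℚ-ring

    Σ₁-≋ : ∀ m {f g : ℕ → ℚ} → (∀ j → j ℕ.< m → f (suc j) ≋ g (suc j)) → Σ₁ m f ≋ Σ₁ m g
    Σ₁-≋ zero    f≋g = ≋-reflexive refl
    Σ₁-≋ (suc m) f≋g = ≋-+ (Σ₁-≋ m (λ j j<m → f≋g j (ℕP.m<n⇒m<1+n j<m))) (f≋g m (ℕP.n<1+n m))

    private
      p-1 = ℕ.pred p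
      1+[p-1]≡p : suc p-1 ≡ p
      1+[p-1]≡p = ℕP.suc-pred p

    p∤1+j : ∀ {j} → suc j ℕ.< p → p ∤ suc j
    p∤1+j 1+j<p p∣1+j = ℕP.<⇒≱ 1+j<p (∣⇒≤ p∣1+j)

    k*pCk≡p*[p-1]C[k-1] : ∀ j → suc j ℕ.* (p C suc j) ≡ p ℕ.* (p-1 C j)
    k*pCk≡p*[p-1]C[k-1] j = subst (λ n → suc j ℕ.* (n C suc j) ≡ n ℕ.* (p-1 C j)) 1+[p-1]≡p
                                   ([k+1]*[n+1]C[k+1]≡[n+1]*nCk p-1 j)

    p∣pC[1+j] : ∀ {j} → suc j ℕ.< p → p ∣ p C suc j
    p∣pC[1+j] {j} 1+j<p with euclidsLemma (suc j) (p C suc j) pr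
                                   (subst (p ∣_) (sym (k*pCk≡p*[p-1]C[k-1] j)) (m∣m*n (p-1 C j)))
    ... | inj₁ p∣1+j = ⊥-elim (p∤1+j 1+j<p p∣1+j)
    ... | inj₂ p∣pC  = p∣pC

    [p-1]Cj*[-1]^j≡1 : ∀ j → j ℕ.< p → Divisible (fromℤ (+ (p-1 C j)) * (- 1ℚ) ^ℚ j - 1ℚ)
    [p-1]Cj*[-1]^j≡1 zero    _     = 0-divisible
    [p-1]Cj*[-1]^j≡1 (suc j) 1+j<p = subst Divisible (sym step)
      (+-divisible {σ * fromℤ (+ (p C suc j))} {c * s - 1ℚ}
        (*-divisible {σ} {fromℤ (+ (p C suc j))} (*-integral { - 1ℚ} {s} p∤1 (^-integral j p∤1))
                     (fromℤ-divisible {+ (p C suc j)} (p∣pC[1+j] 1+j<p)))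
        ([p-1]Cj*[-1]^j≡1 j (ℕP.<-trans (ℕP.n<1+n j) 1+j<p)))
      where
      open ≡-Reasoning
      c  = fromℤ (+ (p-1 C j))
      c′ = fromℤ (+ (p-1 C suc j))
      s  = (- 1ℚ) ^ℚ j
      σ  = (- 1ℚ) * s
      pascal : fromℤ (+ (p C suc j)) ≡ c + c′
      pascal = begin
        fromℤ (+ (p C suc j))                     ≡⟨ cong (λ n → fromℤ (+ (n C suc j))) 1+[p-1]≡p ⟨
        fromℤ (+ (suc p-1 C suc j))               ≡⟨ cong (λ n → fromℤ (+ n)) (nCk+nC[k+1]≡[n+1]C[k+1] p-1 j) ⟨
        fromℤ (+ (p-1 C j ℕ.+ p-1 C suc j))      ≡⟨ cong fromℤ (ℤP.pos-+ (p-1 C j) (p-1 C suc j)) ⟩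
        fromℤ (+ (p-1 C j) ℤ.+ + (p-1 C suc j))  ≡⟨ fromℤ-homo-+ (+ (p-1 C j)) (+ (p-1 C suc j)) ⟩
        c + c′                                    ∎
      step : c′ * σ - 1ℚ ≡ σ * fromℤ (+ (p C suc j)) + (c * s - 1ℚ)
      step = trans (telescope c c′ s) (cong (λ x → σ * x + (c * s - 1ℚ)) (sym pascal))
        where
        telescope : ∀ c c′ s → c′ * ((- 1ℚ) * s) - 1ℚ ≡ ((- 1ℚ) * s) * (c + c′) + (c * s - 1ℚ)
        telescope = RingSolver.solve-∀ ℚ-ring

    binomialTerm/p≋ : ∀ j → suc j ℕ.< p →
      (binomialTerm p (suc j) * (+ 1 / p)) ≋ (- 2^k/k (suc j))
    binomialTerm/p≋ j 1+j<p = mk≋ (subst Divisible (sym difference)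
      (*-divisible {(- 1ℚ) * (w * ρk)} {c * s - 1ℚ}
        (*-integral { - 1ℚ} {w * ρk} p∤1
          (*-integral {w} {ρk} (^-integral {fromℤ (+ 2)} (suc j) p∤1) (/-integral (+ 1) (suc j) (p∤1+j 1+j<p))))
        ([p-1]Cj*[-1]^j≡1 j (ℕP.<-trans (ℕP.n<1+n j) 1+j<p))))
      where
      open ≡-Reasoning
      a  = fromℤ (+ (p C suc j))
      c  = fromℤ (+ (p-1 C j))
      s  = (- 1ℚ) ^ℚ j
      w  = fromℤ (+ 2) ^ℚ suc j
      ρk = + 1 / suc j
      ρp = + 1 / p
      a/p≡c/k : a * ρp ≡ c * ρk
      a/p≡c/k = begin
        a * ρp                ≡⟨ /-as-* (+ (p C suc j)) p ⟨
        + (p C suc j) / p     ≡⟨ *≡*⇒/≡ (+ (p C suc j)) p (+ (p-1 C j)) (suc j) cross ⟩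
        + (p-1 C j) / suc j   ≡⟨ /-as-* (+ (p-1 C j)) (suc j) ⟩
        c * ρk                ∎
        where
        cross : + (p C suc j) ℤ.* + suc j ≡ + (p-1 C j) ℤ.* + p
        cross = begin
          + (p C suc j) ℤ.* + suc j     ≡⟨ ℤP.pos-* (p C suc j) (suc j) ⟨
          + ((p C suc j) ℕ.* suc j)     ≡⟨ cong +_ (ℕP.*-comm (p C suc j) (suc j)) ⟩
          + (suc j ℕ.* (p C suc j))     ≡⟨ cong +_ (k*pCk≡p*[p-1]C[k-1] j) ⟩
          + (p ℕ.* (p-1 C j))           ≡⟨ cong +_ (ℕP.*-comm p (p-1 C j)) ⟩
          + ((p-1 C j) ℕ.* p)           ≡⟨ ℤP.pos-* (p-1 C j) p ⟩
          + (p-1 C j) ℤ.* + p           ∎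
      difference : binomialTerm p (suc j) * ρp - - (w * ρk) ≡ ((- 1ℚ) * (w * ρk)) * (c * s - 1ℚ)
      difference = begin
        a * -2ℚ ^ℚ suc j * ρp - - (w * ρk)
          ≡⟨ cong (λ x → a * x * ρp - - (w * ρk)) (^-distrib-* (- 1ℚ) (fromℤ (+ 2)) (suc j)) ⟩
        a * ((- 1ℚ) * s * w) * ρp - - (w * ρk)   ≡⟨ regroup a ρp s w ρk ⟩
        (a * ρp) * ((- 1ℚ) * s * w) + w * ρk     ≡⟨ cong (λ x → x * ((- 1ℚ) * s * w) + w * ρk) a/p≡c/k ⟩
        (c * ρk) * ((- 1ℚ) * s * w) + w * ρk     ≡⟨ collect c ρk s w ⟩
        ((- 1ℚ) * (w * ρk)) * (c * s - 1ℚ)       ∎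
        where
        regroup : ∀ a ρp s w ρk → a * ((- 1ℚ) * s * w) * ρp - - (w * ρk) ≡ (a * ρp) * ((- 1ℚ) * s * w) + w * ρk
        regroup = RingSolver.solve-∀ ℚ-ring
        collect : ∀ c ρk s w → (c * ρk) * ((- 1ℚ) * s * w) + w * ρk ≡ ((- 1ℚ) * (w * ρk)) * (c * s - 1ℚ)
        collect = RingSolver.solve-∀ ℚ-ring

    Σ₁-multiplesOf3/p≋ : ∀ m → m ℕ.* 3 ℕ.< p →
      (Σ₁ m (λ j → binomialTerm p (j ℕ.* 3)) * (+ 1 / p)) ≋
      ((-[1+ 0 ] / 3) * Σ₁ m (λ k → (+ (8 ℕ.^ k)) / suc (k ∸ 1)))
    Σ₁-multiplesOf3/p≋ m 3m<p =
      ≋-trans (≋-reflexive (Σ₁-*ʳ m (λ j → binomialTerm p (j ℕ.* 3)) (+ 1 / p)))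
      (≋-trans (Σ₁-≋ m {g = λ j → - 2^k/k (j ℕ.* 3)}
                  (λ i i<m → binomialTerm/p≋ (2 ℕ.+ i ℕ.* 3) (ℕP.≤-<-trans (ℕP.*-monoˡ-≤ 3 i<m) 3m<p)))
               (≋-reflexive (trans (Σ₁-cong m term) (Σ₁-*ˡ m (-[1+ 0 ] / 3) (λ k → (+ (8 ℕ.^ k)) / suc (k ∸ 1))))))
      where
      open ≡-Reasoning
      term : ∀ i → - 2^k/k (suc i ℕ.* 3) ≡
                   (-[1+ 0 ] / 3) * ((+ (8 ℕ.^ suc i)) / suc i)
      term i = begin
        - (fromℤ (+ 2) ^ℚ (suc i ℕ.* 3) * (+ 1 / (suc i ℕ.* 3)))
          ≡⟨ cong₂ (λ x y → - (x * y)) (2^[i*3]≡8^i (suc i)) (1/-distrib-* (suc i) 3) ⟩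
        - (fromℤ (+ 8) ^ℚ suc i * ((+ 1 / suc i) * (+ 1 / 3)))
          ≡⟨ third (fromℤ (+ 8) ^ℚ suc i) (+ 1 / suc i) ⟩
        (-[1+ 0 ] / 3) * (fromℤ (+ 8) ^ℚ suc i * (+ 1 / suc i))
          ≡⟨ cong (λ x → (-[1+ 0 ] / 3) * x) (^/-as-* 8 (suc i) (suc i)) ⟨
        (-[1+ 0 ] / 3) * ((+ (8 ℕ.^ suc i)) / suc i) ∎
        where
        third : ∀ x ρ → - (x * (ρ * (+ 1 / 3))) ≡ (-[1+ 0 ] / 3) * (x * ρ)
        third = RingSolver.solve-∀ ℚ-ring

    Σ₁-oneModulo3/p≋ : ∀ m → m ℕ.* 3 ∸ 2 ℕ.< p →
      (Σ₁ m (λ j → binomialTerm p (j ℕ.* 3 ∸ 2)) * (+ 1 / p)) ≋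
      ((-[1+ 0 ] / 4) * Σ₁ m (λ k → (+ (8 ℕ.^ k)) / suc (3 ℕ.* k ∸ 3)))
    Σ₁-oneModulo3/p≋ m bound =
      ≋-trans (≋-reflexive (Σ₁-*ʳ m (λ j → binomialTerm p (j ℕ.* 3 ∸ 2)) (+ 1 / p)))
      (≋-trans (Σ₁-≋ m {g = λ j → - 2^k/k (j ℕ.* 3 ∸ 2)}
                  (λ i i<m → binomialTerm/p≋ (i ℕ.* 3) (ℕP.≤-<-trans (ℕP.∸-monoˡ-≤ 2 (ℕP.*-monoˡ-≤ 3 i<m)) bound)))
               (≋-reflexive (trans (Σ₁-cong m term) (Σ₁-*ˡ m (-[1+ 0 ] / 4) (λ k → (+ (8 ℕ.^ k)) / suc (3 ℕ.* k ∸ 3))))))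
      where
      open ≡-Reasoning
      3[i+1]∸3≡i*3 : ∀ i → 3 ℕ.* suc i ∸ 3 ≡ i ℕ.* 3
      3[i+1]∸3≡i*3 i = trans (cong (_∸ 3) (ℕP.*-suc 3 i)) (trans (ℕP.m+n∸m≡n 3 (3 ℕ.* i)) (ℕP.*-comm 3 i))
      term : ∀ i → - 2^k/k (suc i ℕ.* 3 ∸ 2) ≡ (-[1+ 0 ] / 4) * ((+ (8 ℕ.^ suc i)) / suc (3 ℕ.* suc i ∸ 3))
      term i = begin
        - (fromℤ (+ 2) * fromℤ (+ 2) ^ℚ (i ℕ.* 3) * (+ 1 / suc (i ℕ.* 3)))
          ≡⟨ cong (λ x → - (fromℤ (+ 2) * x * (+ 1 / suc (i ℕ.* 3)))) (2^[i*3]≡8^i i) ⟩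
        - (fromℤ (+ 2) * fromℤ (+ 8) ^ℚ i * (+ 1 / suc (i ℕ.* 3)))
          ≡⟨ quarter (fromℤ (+ 8) ^ℚ i) (+ 1 / suc (i ℕ.* 3)) ⟩
        (-[1+ 0 ] / 4) * (fromℤ (+ 8) ^ℚ suc i * (+ 1 / suc (i ℕ.* 3)))
          ≡⟨ cong (λ x → (-[1+ 0 ] / 4) * x) (^/-as-* 8 (suc i) (suc (i ℕ.* 3))) ⟨
        (-[1+ 0 ] / 4) * ((+ (8 ℕ.^ suc i)) / suc (i ℕ.* 3))
          ≡⟨ cong (λ x → (-[1+ 0 ] / 4) * x) (ℚP./-cong {+ (8 ℕ.^ suc i)} refl (cong suc (3[i+1]∸3≡i*3 i))) ⟨
        (-[1+ 0 ] / 4) * ((+ (8 ℕ.^ suc i)) / suc (3 ℕ.* suc i ∸ 3)) ∎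
        where
        quarter : ∀ x ρ → - (fromℤ (+ 2) * x * ρ) ≡ (-[1+ 0 ] / 4) * (fromℤ (+ 8) * x * ρ)
        quarter = RingSolver.solve-∀ ℚ-ring

  -- Parity and residues modulo 3

  -1^[1+h*2] : ∀ h → (- 1ℚ) ^ℚ suc (h ℕ.* 2) ≡ - 1ℚ
  -1^[1+h*2] zero    = refl
  -1^[1+h*2] (suc h) = cong (λ x → (- 1ℚ) * ((- 1ℚ) * x)) (-1^[1+h*2] h)

  prime∤prime : ∀ {p q} → Prime p → Prime q → p ≢ q → p ∤ q
  prime∤prime pr prq p≢q p∣q with prime⇒irreducible prq p∣q
  ... | inj₁ p≡1 = ¬prime[1] (subst Prime p≡1 pr)
  ... | inj₂ p≡q = p≢q p≡q

  prime≢2⇒odd : ∀ {p} → Prime p → p ≢ 2 → p ≡ suc (p ℕ./ 2 ℕ.* 2)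
  prime≢2⇒odd {p} pr p≢2 with p % 2 | m%n<n p 2 | m≡m%n+[m/n]*n p 2
  ... | 0           | _                  | p≡[p/2]*2 =
    ⊥-elim (prime∤prime prime[2] pr (λ 2≡p → p≢2 (sym 2≡p)) (divides (p ℕ./ 2) p≡[p/2]*2))
  ... | 1           | _                  | p≡1+[p/2]*2 = p≡1+[p/2]*2
  ... | suc (suc _) | ℕ.s≤s (ℕ.s≤s ()) | _

  prime≢2⇒-1^p≡-1 : ∀ {p} → Prime p → p ≢ 2 → (- 1ℚ) ^ℚ p ≡ - 1ℚ
  prime≢2⇒-1^p≡-1 {p} pr p≢2 = trans (cong ((- 1ℚ) ^ℚ_) (prime≢2⇒odd pr p≢2)) (-1^[1+h*2] (p ℕ./ 2))

  n≡r+[n∸r]/3*3 : ∀ n {r} → n % 3 ≡ r → n ≡ r ℕ.+ (n ∸ r) ℕ./ 3 ℕ.* 3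
  n≡r+[n∸r]/3*3 n {r} n%3≡r = trans n≡r+[n/3]*3 (cong (λ k → r ℕ.+ k ℕ.* 3) (sym [n∸r]/3≡n/3))
    where
    n≡r+[n/3]*3 : n ≡ r ℕ.+ n ℕ./ 3 ℕ.* 3
    n≡r+[n/3]*3 = trans (m≡m%n+[m/n]*n n 3) (cong (ℕ._+ n ℕ./ 3 ℕ.* 3) n%3≡r)
    [n∸r]/3≡n/3 : (n ∸ r) ℕ./ 3 ≡ n ℕ./ 3
    [n∸r]/3≡n/3 = trans (cong (λ x → (x ∸ r) ℕ./ 3) n≡r+[n/3]*3)
                        (trans (cong (ℕ._/ 3) (ℕP.m+n∸m≡n r (n ℕ./ 3 ℕ.* 3))) (m*n/n≡m (n ℕ./ 3) 3))

  [n+1]/3≡1+[n∸2]/3 : ∀ n → n % 3 ≡ 2 → (n ℕ.+ 1) ℕ./ 3 ≡ suc ((n ∸ 2) ℕ./ 3)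
  [n+1]/3≡1+[n∸2]/3 n n%3≡2 =
    trans (cong (ℕ._/ 3) (trans (ℕP.+-comm n 1) (cong suc (n≡r+[n∸r]/3*3 n n%3≡2)))) (m*n/n≡m (suc ((n ∸ 2) ℕ./ 3)) 3)

  prime[7] : Prime 7
  prime[7] = from-yes (prime? 7)

  u[p-1]/p≋ : ∀ {m p} (pr : Prime p) → p ≡ suc (m ℕ.* 3) → p ≢ 2 → p ≢ 7 →
    let open Modulo pr in
    (u (p ∸ 1) /ₚ p [ pr ]) ≋
      ((+ 5 / 42) * Σ₁ m (λ k → (+ (8 ℕ.^ k)) / suc (k ∸ 1))
       + (+ 1 / 14) * Σ₁ m (λ k → (+ (8 ℕ.^ k)) / suc (3 ℕ.* k ∸ 3))
       + (+ 4 / 7) * q p pr 2)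
  u[p-1]/p≋ {m} {p} pr refl p≢2 p≢7 =
    ≋-trans (≋-reflexive exact)
    (≋-trans (≋-+ (≋-+ (≋-*ˡ { -[1+ 4 ] / 14} (/-integral -[1+ 4 ] 14 (∤-* p∤2 p∤7))
                                (Σ₁-multiplesOf3/p≋ m (ℕP.n<1+n (m ℕ.* 3))))
                        (≋-*ˡ { -[1+ 1 ] / 7} (/-integral -[1+ 1 ] 7 p∤7)
                                (Σ₁-oneModulo3/p≋ m (ℕ.s≤s (ℕP.m∸n≤m (m ℕ.* 3) 2)))))
                  (≋-reflexive {(+ 4 / 7) * q p pr 2} refl))
             (≋-reflexive (coefficients S₀ S₁ (q p pr 2))))
    where
    open Modulo pr
    open ≡-Reasoning
    p∤2 = prime∤prime pr prime[2] p≢2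
    p∤7 = prime∤prime pr prime[7] p≢7
    odd = prime≢2⇒-1^p≡-1 pr p≢2
    S₀ = Σ₁ m (λ k → (+ (8 ℕ.^ k)) / suc (k ∸ 1))
    S₁ = Σ₁ m (λ k → (+ (8 ℕ.^ k)) / suc (3 ℕ.* k ∸ 3))
    ρp = + 1 / p
    A₀ = Σ₁ m (λ j → binomialTerm p (j ℕ.* 3))
    A₁ = Σ₁ m (λ j → binomialTerm p (j ℕ.* 3 ∸ 2))
    W = fromℤ (+ 2) ^ℚ (m ℕ.* 3)
    q≡ : q p pr 2 ≡ (W - 1ℚ) * ρp
    q≡ = begin
      (+ (2 ℕ.^ (m ℕ.* 3)) ℤ.- + 1) / p              ≡⟨ /-as-* (+ (2 ℕ.^ (m ℕ.* 3)) ℤ.- + 1) p ⟩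
      fromℤ (+ (2 ℕ.^ (m ℕ.* 3)) ℤ.- + 1) * ρp       ≡⟨ cong (_* ρp) (fromℤ-homo-- (+ (2 ℕ.^ (m ℕ.* 3))) (+ 1)) ⟩
      (fromℤ (+ (2 ℕ.^ (m ℕ.* 3))) - 1ℚ) * ρp        ≡⟨ cong (λ x → (x - 1ℚ) * ρp) (fromℤ-homo-^ 2 (m ℕ.* 3)) ⟩
      (W - 1ℚ) * ρp                                   ∎
    exact : u (m ℕ.* 3) /ₚ p [ pr ] ≡ (-[1+ 4 ] / 14) * (A₀ * ρp) + (-[1+ 1 ] / 7) * (A₁ * ρp) + (+ 4 / 7) * q p pr 2
    exact = begin
      u (m ℕ.* 3) / p                                                         ≡⟨ /-as-* (u (m ℕ.* 3)) p ⟩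
      fromℤ (u (m ℕ.* 3)) * ρp                                                ≡⟨ cong (_* ρp) (u[m*3]-expansion m odd) ⟩
      ((-[1+ 4 ] / 14) * A₀ + (-[1+ 1 ] / 7) * A₁ + (+ 4 / 7) * (W - 1ℚ)) * ρp ≡⟨ distribute A₀ A₁ (W - 1ℚ) ρp ⟩
      (-[1+ 4 ] / 14) * (A₀ * ρp) + (-[1+ 1 ] / 7) * (A₁ * ρp) + (+ 4 / 7) * ((W - 1ℚ) * ρp)
        ≡⟨ cong (λ x → (-[1+ 4 ] / 14) * (A₀ * ρp) + (-[1+ 1 ] / 7) * (A₁ * ρp) + (+ 4 / 7) * x) q≡ ⟨
      (-[1+ 4 ] / 14) * (A₀ * ρp) + (-[1+ 1 ] / 7) * (A₁ * ρp) + (+ 4 / 7) * q p pr 2 ∎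
      where
      distribute : ∀ a b c ρ → ((-[1+ 4 ] / 14) * a + (-[1+ 1 ] / 7) * b + (+ 4 / 7) * c) * ρ ≡
                               (-[1+ 4 ] / 14) * (a * ρ) + (-[1+ 1 ] / 7) * (b * ρ) + (+ 4 / 7) * (c * ρ)
      distribute = RingSolver.solve-∀ ℚ-ring
    coefficients : ∀ S₀ S₁ Q →
      (-[1+ 4 ] / 14) * ((-[1+ 0 ] / 3) * S₀) + (-[1+ 1 ] / 7) * ((-[1+ 0 ] / 4) * S₁) + (+ 4 / 7) * Q ≡
      (+ 5 / 42) * S₀ + (+ 1 / 14) * S₁ + (+ 4 / 7) * Q
    coefficients = RingSolver.solve-∀ ℚ-ring

  u[p+1]/p≋ : ∀ {m M p} (pr : Prime p) → p ≡ 2 ℕ.+ m ℕ.* 3 → M ≡ suc m → p ≢ 2 →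
    let open Modulo pr in
    (u (p ℕ.+ 1) /ₚ p [ pr ]) ≋
      ((+ 1 / 2) * Σ₁ M (λ k → (+ (8 ℕ.^ k)) / suc (3 ℕ.* k ∸ 3))
       - (+ 1 / 6) * Σ₁ m (λ k → (+ (8 ℕ.^ k)) / suc (k ∸ 1)))
  u[p+1]/p≋ {m} {M} {p} pr refl refl p≢2 =
    ≋-trans (≋-reflexive exact)
    (≋-trans (≋-+ (≋-*ˡ {+ 1 / 2} (/-integral (+ 1) 2 p∤2) (Σ₁-multiplesOf3/p≋ m (ℕP.m<n⇒m<1+n (ℕP.n<1+n (m ℕ.* 3)))))
                  (≋-*ˡ { -2ℚ} (fromℤ-integral -[1+ 1 ]) (Σ₁-oneModulo3/p≋ (suc m) (ℕP.n<1+n (suc (m ℕ.* 3))))))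
             (≋-reflexive (coefficients S₀ S₁)))
    where
    open Modulo pr
    open ≡-Reasoning
    p∤2 = prime∤prime pr prime[2] p≢2
    odd = prime≢2⇒-1^p≡-1 pr p≢2
    S₀ = Σ₁ m (λ k → (+ (8 ℕ.^ k)) / suc (k ∸ 1))
    S₁ = Σ₁ (suc m) (λ k → (+ (8 ℕ.^ k)) / suc (3 ℕ.* k ∸ 3))
    ρp = + 1 / p
    A₀ = Σ₁ m (λ j → binomialTerm p (j ℕ.* 3))
    A₁ = Σ₁ (suc m) (λ j → binomialTerm p (j ℕ.* 3 ∸ 2))
    exact : u (p ℕ.+ 1) /ₚ p [ pr ] ≡ (+ 1 / 2) * (A₀ * ρp) + -2ℚ * (A₁ * ρp)
    exact = begin
      u (p ℕ.+ 1) / p                              ≡⟨ /-as-* (u (p ℕ.+ 1)) p ⟩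
      fromℤ (u (p ℕ.+ 1)) * ρp                     ≡⟨ cong (λ n → fromℤ (u n) * ρp) (ℕP.+-comm p 1) ⟩
      fromℤ (u (suc p)) * ρp                       ≡⟨ cong (_* ρp) (u[3+m*3]-expansion m odd) ⟩
      ((+ 1 / 2) * A₀ + -2ℚ * A₁) * ρp             ≡⟨ distribute A₀ A₁ ρp ⟩
      (+ 1 / 2) * (A₀ * ρp) + -2ℚ * (A₁ * ρp)      ∎
      where
      distribute : ∀ a b ρ → ((+ 1 / 2) * a + -2ℚ * b) * ρ ≡ (+ 1 / 2) * (a * ρ) + -2ℚ * (b * ρ)
      distribute = RingSolver.solve-∀ ℚ-ring
    coefficients : ∀ S₀ S₁ → (+ 1 / 2) * ((-[1+ 0 ] / 3) * S₀) + -2ℚ * ((-[1+ 0 ] / 4) * S₁) ≡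
                             (+ 1 / 2) * S₁ - (+ 1 / 6) * S₀
    coefficients = RingSolver.solve-∀ ℚ-ring

open import Data.Nat as ℕ using (ℕ; zero; suc; _∸_; _^_; _*_; _+_; _%_; _/_)
open import Data.Nat.Primality using (Prime)
open import Data.Integer using (+_)
open import Data.Rational as ℚ using (ℚ)
open import Data.Product using (_×_; _,_)
open import Relation.Binary.PropositionalEquality using (_≡_; _≢_)

corollary4p4 : (p : ℕ) → (pr : Prime p) → p ≢ 2 → p ≢ 3 → p ≢ 7 →
    (p % 3 ≡ 1 →
      u (p ∸ 1) /ₚ p [ pr ] ≡
        ((+ 5) ℚ./ 42) ℚ.* Σ₁ ((p ∸ 1) / 3) (λ k → (+ (8 ^ k)) ℚ./ suc (k ∸ 1))
        ℚ.+ ((+ 1) ℚ./ 14) ℚ.* Σ₁ ((p ∸ 1) / 3) (λ k → (+ (8 ^ k)) ℚ./ suc (3 * k ∸ 3))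
        ℚ.+ ((+ 4) ℚ./ 7) ℚ.* q p pr 2
        [modℚ p ])
    × (p % 3 ≡ 2 →
      u (p + 1) /ₚ p [ pr ] ≡
        ((+ 1) ℚ./ 2) ℚ.* Σ₁ ((p + 1) / 3) (λ k → (+ (8 ^ k)) ℚ./ suc (3 * k ∸ 3))
        ℚ.- ((+ 1) ℚ./ 6) ℚ.* Σ₁ ((p ∸ 2) / 3) (λ k → (+ (8 ^ k)) ℚ./ suc (k ∸ 1))
        [modℚ p ])
corollary4p4 p pr p≢2 _ p≢7 =
    (λ p%3≡1 → ≋⇒≡[modℚ] (u[p-1]/p≋ {(p ∸ 1) / 3} pr (n≡r+[n∸r]/3*3 p p%3≡1) p≢2 p≢7))
  , (λ p%3≡2 → ≋⇒≡[modℚ] (u[p+1]/p≋ {(p ∸ 2) / 3} pr (n≡r+[n∸r]/3*3 p p%3≡2) ([n+1]/3≡1+[n∸2]/3 p p%3≡2) p≢2))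
  where open Modulo pr using (≋⇒≡[modℚ])
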